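{- Let $G=(V,E)$ be an edge-weighted tree with distinct edge ranks, and let $D$ be its single-linkage dendrogram. Let $e=(u,v)\in E$. Let $D^u(e)$ denote the subtree of $D$ rooted at the child of node $e$ that contains the leaf $u$, and $D^v(e)$ the subtree rooted at the child of node $e$ that contains the leaf $v$. Then the set of edges corresponding to internal nodes of $D^u(e)$ equals $\mathcal{I}^u(e)$, and the set of edges corresponding to internal nodes of $D^v(e)$ equals $\mathcal{I}^v(e)$.
   Context: Let $G=(V,E)$ be a tree with real edge weights. Each edge $e$ has a rank $r_e$, its position when the edges are sorted by weight in increasing order with ties broken consistently, so ranks are distinct. The single-linkage dendrogram (SLD) $D$ of $G$ is defined by the following process. Start with every vertex in its own cluster, and process the edges in increasing order of rank; processing $e=(u,v)$ merges the current cluster of $u$ with the current cluster of $v$. $D$ is the rooted binary tree whose leaves are the vertices of $V$ and whose internal nodes are the edges of $E$ ("node $e$"). The two children of node $e$ represent the two clusters merged when $e$ is processed: a leaf if that cluster is a single vertex, and otherwise the edge whose processing created that cluster. An edge $f$ is an adjacent inferior of $e$ if $r_f<r_e$ and every edge $g$ on the unique path in $G$ strictly between $e$ and $f$ has $r_g<r_e$. $\mathcal{I}^u(e)$ is the set of adjacent inferiors of $e$ lying on $u$'s side of $e$ (closer to $u$ than to $v$), and $\mathcal{I}^v(e)$ is the analogous set on $v$'s side. -}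

module Defs where

open import Data.Nat using (ℕ; _<_)
open import Data.Fin using (Fin; toℕ; _≟_)
open import Data.Fin.Properties using ()
open import Data.Bool using (Bool; true; false; _∨_; if_then_else_)
open import Data.List using (List; []; _∷_; map; foldl; allFin)
open import Data.List.Membership.Propositional using (_∈_; _∉_)
open import Data.List.Relation.Unary.All using (All)
open import Data.List.Relation.Unary.Unique.Propositional using (Unique)
open import Data.Maybe using (Maybe; just; nothing)
open import Data.Product using (Σ; ∃; _×_; _,_; proj₁; proj₂)
open import Data.Sum using (_⊎_)
open import Relation.Binary.PropositionalEquality using (_≡_; _≢_)
open import Relation.Nullary.Decidable using (⌊_⌋)
open import Function.Bundles using (_↔_; Inverse)

Ends : ℕ → ℕ → Set
Ends n m = Fin m → Fin n × Fin n

module _ {n m : ℕ} (ends : Ends n m) where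

  Joins : Fin m → Fin n → Fin n → Set
  Joins g x z = ends g ≡ (x , z) ⊎ ends g ≡ (z , x)

  data Walk : Fin n → Fin n → List (Fin m) → List (Fin n) → Set where
    here : ∀ {x} → Walk x x [] (x ∷ [])
    step : ∀ {g x z y es vs} → Joins g x z → Walk z y es vs →
           Walk x y (g ∷ es) (x ∷ vs)

  Path : Fin n → Fin n → List (Fin m) → Set
  Path x y es = Σ (List (Fin n)) λ vs → Walk x y es vs × Unique vs

  IsTree : Set
  IsTree = (∀ g → proj₁ (ends g) ≢ proj₂ (ends g))
         × (∀ x y → ∃ λ es → Path x y es)
         × (∀ x y es es′ → Path x y es → Path x y es′ → es ≡ es′)

  -- Ranks: a bijection rk from edges to {0,…,m-1}; r f = position of f
  -- in the increasing order of the edges.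

  module Ranked (rk : Fin m ↔ Fin m) where

    r : Fin m → ℕ
    r g = toℕ (Inverse.to rk g)

    -- f is an adjacent inferior of e lying on w's side of e, where w is
    -- an endpoint of e: r f < r e and, for some endpoint x of f, the
    -- (unique) path from w to x avoids e and f (so it is exactly the
    -- path strictly between e and f, and f lies on w's side), and every
    -- edge g on it has r g < r e.
    AdjInf : Fin m → Fin n → Fin m → Set
    AdjInf e w f =
      r f < r e ×
      ∃ λ x → (x ≡ proj₁ (ends f) ⊎ x ≡ proj₂ (ends f)) ×
      ∃ λ es → Path w x es × e ∉ es × f ∉ es × All (λ g → r g < r e) es

    -- Single-linkage dendrogram, built by literally running the process.

    data BT : Set where
      leaf : Fin n → BT
      node : Fin m → BT → BT → BT

    hasLeaf : Fin n → BT → Bool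
    hasLeaf x (leaf y) = ⌊ x ≟ y ⌋
    hasLeaf x (node _ l r′) = hasLeaf x l ∨ hasLeaf x r′

    extract : Fin n → List BT → Maybe (BT × List BT)
    extract x [] = nothing
    extract x (t ∷ ts) with hasLeaf x t
    ... | true = just (t , ts)
    ... | false with extract x ts
    ...   | nothing = nothing
    ...   | just (s , ss) = just (s , t ∷ ss)

    merge : List BT → Fin m → List BT
    merge F e with extract (proj₁ (ends e)) F
    ... | nothing = F
    ... | just (tu , F′) with extract (proj₂ (ends e)) F′
    ...   | nothing = F
    ...   | just (tv , F″) = node e tu tv ∷ F″

    sortedEdges : List (Fin m)
    sortedEdges = map (Inverse.from rk) (allFin m)

    -- the final list of clusters (a single dendrogram when G is a tree)
    SLD : List BT
    SLD = foldl merge (map leaf (allFin n)) sortedEdges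

    data _⊑_ : BT → BT → Set where
      ⊑-refl : ∀ {t} → t ⊑ t
      ⊑-left : ∀ {s g l r′} → s ⊑ l → s ⊑ node g l r′
      ⊑-right : ∀ {s g l r′} → s ⊑ r′ → s ⊑ node g l r′

    data LeafIn (x : Fin n) : BT → Set where
      lf : LeafIn x (leaf x)
      inl : ∀ {g l r′} → LeafIn x l → LeafIn x (node g l r′)
      inr : ∀ {g l r′} → LeafIn x r′ → LeafIn x (node g l r′)

    data InternalNode (f : Fin m) : BT → Set where
      top : ∀ {l r′} → InternalNode f (node f l r′)
      inl : ∀ {g l r′} → InternalNode f l → InternalNode f (node g l r′)
      inr : ∀ {g l r′} → InternalNode f r′ → InternalNode f (node g l r′)

{-# OPTIONS --safe #-}
-- Processing the edges in rank order maintains the invariant that every current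
-- cluster is a connected component of the subgraph G<k of the edges processed so
-- far, with internal nodes exactly the edges of that component. In a tree the
-- endpoints of e are not connected in G<r(e), so processing e merges two distinct
-- clusters and both children of node e are components of G<r(e). For such a
-- component containing w, an edge f lies in it iff r f < r e and w reaches f
-- along edges of rank < r e; cutting that walk before its first use of f and
-- shortening it to a path gives exactly the adjacent-inferior condition.
module Submission where

open import Defs
open import Data.Nat using (ℕ; zero; suc; _<_; _+_)
open import Data.Nat.Properties using (<-irrefl; n<1+n; m<n⇒m<1+n; m<1+n⇒m<n∨m≡n; +-identityʳ; +-suc)
open import Data.Fin using (Fin; toℕ; _≟_)
import Data.Fin as Fin
open import Data.Fin.Properties using (toℕ-injective)
open import Data.Bool using (T; true; false; _∨_)
open import Data.Bool.Properties using (T-≡; T-∨)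
open import Data.List using (List; []; _∷_; map; foldl; allFin; tabulate)
open import Data.List.Properties using (map-tabulate)
open import Data.List.Membership.Propositional using (_∈_; _∉_)
open import Data.List.Membership.Propositional.Properties using (∈-allFin)
open import Data.List.Relation.Binary.Subset.Propositional using (_⊆_)
open import Data.List.Relation.Binary.Subset.Propositional.Properties using (All-resp-⊇; ∷⁺ʳ)
open import Data.List.Relation.Binary.Permutation.Propositional using (_↭_; ↭-refl; ↭-trans; ↭-prep; ↭-swap; ↭⇒↭ₛ)
open import Data.List.Relation.Binary.Permutation.Propositional.Properties using (All-resp-↭; Any-resp-↭)
import Data.List.Relation.Binary.Permutation.Setoid.Properties as SetoidPermutation
open import Data.List.Relation.Unary.Any as Any using (Any; here; there)
import Data.List.Relation.Unary.Any.Properties as Anyₚ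
open import Data.List.Relation.Unary.All as All using (All; []; _∷_)
import Data.List.Relation.Unary.All.Properties as Allₚ
open import Data.List.Relation.Unary.AllPairs as AllPairs using (AllPairs; []; _∷_)
import Data.List.Relation.Unary.AllPairs.Properties as AllPairsₚ
open import Data.List.Relation.Unary.Unique.Propositional using (Unique)
open import Data.List.Relation.Unary.Unique.Propositional.Properties using (allFin⁺)
open import Data.Maybe using (just; nothing)
open import Data.Product using (∃; ∃₂; _×_; _,_; proj₁; proj₂; map₁; map₂)
import Data.Product as Product
open import Data.Sum using (_⊎_; inj₁; inj₂)
import Data.Sum as Sum
open import Data.Empty using (⊥; ⊥-elim)
open import Relation.Nullary using (¬_; yes; no)
open import Relation.Nullary.Decidable using (toWitness; fromWitness)
open import Relation.Binary.Construct.Closure.ReflexiveTransitive as Star using (Star; ε; _◅_; _◅◅_)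
open import Relation.Binary.PropositionalEquality using (_≡_; _≢_; refl; sym; trans; cong; subst; resp₂; setoid)
open import Function using (_∘_; id)
open import Function.Bundles using (_↔_; _⇔_; Inverse; Injection; Equivalence; mk⇔)
open import Function.Properties.Inverse using (Inverse⇒Injection)

module _ {n m : ℕ} (ends : Ends n m) where

  private variable
    f g : Fin m
    w x y z : Fin n
    es : List (Fin m)
    vs : List (Fin n)

  end₁ end₂ : Fin m → Fin n
  end₁ g = proj₁ (ends g)
  end₂ g = proj₂ (ends g)

  Endpoint : Fin m → Fin n → Set
  Endpoint g x = x ≡ end₁ g ⊎ x ≡ end₂ g

  joins-sym : Joins ends g x y → Joins ends g y x
  joins-sym = Sum.swap

  joins-ends : ∀ g → Joins ends g (end₁ g) (end₂ g)
  joins-ends g = inj₁ refl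

  joins⇒endpointˡ : Joins ends g x y → Endpoint g x
  joins⇒endpointˡ = Sum.map (cong proj₁ ∘ sym) (cong proj₂ ∘ sym)

  joins⇒endpointʳ : Joins ends g x y → Endpoint g y
  joins⇒endpointʳ = joins⇒endpointˡ ∘ joins-sym

  path-suffix : Walk ends z y es vs → Unique vs → x ∈ vs → ∃ λ es′ → Path ends x y es′ × es′ ⊆ es
  path-suffix here       U       (here refl) = _ , (_ , here , U) , id
  path-suffix (step j W) U       (here refl) = _ , (_ , step j W , U) , id
  path-suffix (step _ W) (_ ∷ U) (there x∈)  = map₂ (map₂ (λ es′⊆es g∈ → there (es′⊆es g∈))) (path-suffix W U x∈)

  walk⇒path : Walk ends x y es vs → ∃ λ es′ → Path ends x y es′ × es′ ⊆ es
  walk⇒path here = [] , (_ , here , [] ∷ []) , id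
  walk⇒path {x = x} (step {g = g} j W) with walk⇒path W
  ... | es′ , (vs′ , W′ , U′) , es′⊆es with Any.any? (x ≟_) vs′
  ...   | yes x∈ = map₂ (map₂ (λ ⊆es′ g∈ → there (es′⊆es (⊆es′ g∈)))) (path-suffix W′ U′ x∈)
  ...   | no x∉  = g ∷ es′ , (x ∷ vs′ , step j W′ , Allₚ.¬Any⇒All¬ vs′ x∉ ∷ U′) , ∷⁺ʳ g es′⊆es

  walk-prefix-avoiding : Walk ends x y es vs → Endpoint f y →
                         ∃ λ z → Endpoint f z × ∃₂ λ es′ vs′ → Walk ends x z es′ vs′ × f ∉ es′ × es′ ⊆ es
  walk-prefix-avoiding here fy = _ , fy , [] , _ , here , (λ ()) , λ ()
  walk-prefix-avoiding {f = f} (step {g = g} j W) fy with g ≟ f | walk-prefix-avoiding W fy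
  ... | yes refl | _ = _ , joins⇒endpointˡ j , [] , _ , here , (λ ()) , λ ()
  ... | no g≢f   | z , fz , es′ , _ , W′ , f∉es′ , es′⊆es =
    z , fz , g ∷ es′ , _ , step j W′ , Sum.[ g≢f ∘ sym , f∉es′ ] ∘ Any.toSum , ∷⁺ʳ g es′⊆es

  edge-path : ∀ g → end₁ g ≢ end₂ g → Path ends (end₁ g) (end₂ g) (g ∷ [])
  edge-path g loopless = _ , step (joins-ends g) here , (loopless ∷ []) ∷ [] ∷ []

  walk-between-ends-uses-edge : IsTree ends → ∀ g → Walk ends (end₁ g) (end₂ g) es vs → g ∈ es
  walk-between-ends-uses-edge (loopless , _ , paths-unique) g W with walk⇒path W
  ... | es′ , P , es′⊆es with paths-unique _ _ _ _ P (edge-path g (loopless g))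
  ...   | refl = es′⊆es (here refl)

  module _ (rk : Fin m ↔ Fin m) where
    open Ranked ends rk

    private variable
      e : Fin m
      k : ℕ
      a b c s t : BT
      F F′ : List BT

    r-injective : r f ≡ r g → f ≡ g
    r-injective = Injection.injective (Inverse⇒Injection rk) ∘ toℕ-injective

    rank<suc : r f < suc (r e) → r f < r e ⊎ f ≡ e
    rank<suc = Sum.map₂ r-injective ∘ m<1+n⇒m<n∨m≡n

    LowEdge : ℕ → Fin n → Fin n → Set
    LowEdge k x y = ∃ λ g → r g < k × Joins ends g x y

    Linked : ℕ → Fin n → Fin n → Set
    Linked k = Star (LowEdge k)

    linked-sym : Linked k x y → Linked k y x
    linked-sym = Star.reverse (map₂ (map₂ joins-sym))

    linked-suc : Linked k x y → Linked (suc k) x y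
    linked-suc = Star.map (map₂ (map₁ m<n⇒m<1+n))

    linked⇒walk : Linked k x y → ∃₂ λ es vs → Walk ends x y es vs × All (λ g → r g < k) es
    linked⇒walk ε = [] , _ , here , []
    linked⇒walk ((g , low , j) ◅ L) with linked⇒walk L
    ... | es , _ , W , lows = g ∷ es , _ , step j W , low ∷ lows

    walk⇒linked : Walk ends x y es vs → All (λ g → r g < k) es → Linked k x y
    walk⇒linked here       []           = ε
    walk⇒linked (step j W) (low ∷ lows) = (_ , low , j) ◅ walk⇒linked W lows

    ends-unlinked : IsTree ends → ∀ e → ¬ Linked (r e) (end₁ e) (end₂ e)
    ends-unlinked tree e L with linked⇒walk L
    ... | _ , _ , W , lows = <-irrefl refl (All.lookup lows (walk-between-ends-uses-edge tree e W))

    -- The leaves of t form a connected component of G<k and the internal nodes of t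
    -- are the edges of G<k inside it (by closedness, having end₁ in t suffices).
    record Cluster (k : ℕ) (t : BT) : Set where
      field
        linked    : LeafIn x t → LeafIn y t → Linked k x y
        closed₁   : LeafIn x t → LowEdge k x y → LeafIn y t
        internal⇒ : InternalNode f t → r f < k × LeafIn (end₁ f) t
        internal⇐ : r f < k → LeafIn (end₁ f) t → InternalNode f t

      closed : LeafIn x t → Linked k x y → LeafIn y t
      closed x∈ ε            = x∈
      closed x∈ (edge ◅ L) = closed (closed₁ x∈ edge) L

    open Cluster

    cluster-leaf : Cluster 0 (leaf x)
    cluster-leaf = record
      { linked    = λ { lf lf → ε }
      ; closed₁   = λ { _ (_ , () , _) }
      ; internal⇒ = λ ()
      ; internal⇐ = λ ()
      }

    cluster-untouched : Cluster (r e) t → ¬ LeafIn (end₁ e) t → ¬ LeafIn (end₂ e) t →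
                        Cluster (suc (r e)) t
    cluster-untouched {e} {t} C e₁∉t e₂∉t = record
      { linked    = λ x∈ y∈ → linked-suc (linked C x∈ y∈)
      ; closed₁   = closed₁′
      ; internal⇒ = map₁ m<n⇒m<1+n ∘ internal⇒ C
      ; internal⇐ = internal⇐′
      }
      where
        endpoint∉t : Endpoint e x → ¬ LeafIn x t
        endpoint∉t (inj₁ refl) = e₁∉t
        endpoint∉t (inj₂ refl) = e₂∉t

        closed₁′ : LeafIn x t → LowEdge (suc (r e)) x y → LeafIn y t
        closed₁′ x∈ (g , low , j) with rank<suc low
        ... | inj₁ low′ = closed₁ C x∈ (g , low′ , j)
        ... | inj₂ refl = ⊥-elim (endpoint∉t (joins⇒endpointˡ j) x∈)

        internal⇐′ : r f < suc (r e) → LeafIn (end₁ f) t → InternalNode f t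
        internal⇐′ low f₁∈ with rank<suc low
        ... | inj₁ low′ = internal⇐ C low′ f₁∈
        ... | inj₂ refl = ⊥-elim (e₁∉t f₁∈)

    cluster-node : Cluster (r e) a → Cluster (r e) b → LeafIn (end₁ e) a → LeafIn (end₂ e) b →
                   Cluster (suc (r e)) (node e a b)
    cluster-node {e} {a} {b} A B e₁∈a e₂∈b = record
      { linked = linked′ ; closed₁ = closed₁′ ; internal⇒ = internal⇒′ ; internal⇐ = internal⇐′ }
      where
        across : Linked (suc (r e)) (end₁ e) (end₂ e)
        across = Star.return (e , n<1+n (r e) , joins-ends e)

        linked′ : LeafIn x (node e a b) → LeafIn y (node e a b) → Linked (suc (r e)) x y
        linked′ (inl x∈) (inl y∈) = linked-suc (linked A x∈ y∈)
        linked′ (inl x∈) (inr y∈) = linked-suc (linked A x∈ e₁∈a) ◅◅ across ◅◅ linked-suc (linked B e₂∈b y∈)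
        linked′ (inr x∈) (inl y∈) =
          linked-suc (linked B x∈ e₂∈b) ◅◅ linked-sym across ◅◅ linked-suc (linked A e₁∈a y∈)
        linked′ (inr x∈) (inr y∈) = linked-suc (linked B x∈ y∈)

        closed₁′ : LeafIn x (node e a b) → LowEdge (suc (r e)) x y → LeafIn y (node e a b)
        closed₁′ x∈ (g , low , j) with rank<suc low | x∈
        ... | inj₁ low′ | inl x∈a = inl (closed₁ A x∈a (g , low′ , j))
        ... | inj₁ low′ | inr x∈b = inr (closed₁ B x∈b (g , low′ , j))
        ... | inj₂ refl | _ with joins⇒endpointʳ j
        ...   | inj₁ refl = inl e₁∈a
        ...   | inj₂ refl = inr e₂∈b

        internal⇒′ : InternalNode f (node e a b) → r f < suc (r e) × LeafIn (end₁ f) (node e a b)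
        internal⇒′ top     = n<1+n (r e) , inl e₁∈a
        internal⇒′ (inl p) = Product.map m<n⇒m<1+n inl (internal⇒ A p)
        internal⇒′ (inr p) = Product.map m<n⇒m<1+n inr (internal⇒ B p)

        internal⇐′ : r f < suc (r e) → LeafIn (end₁ f) (node e a b) → InternalNode f (node e a b)
        internal⇐′ low f₁∈ with rank<suc low | f₁∈
        ... | inj₁ low′ | inl f₁∈a = inl (internal⇐ A low′ f₁∈a)
        ... | inj₁ low′ | inr f₁∈b = inr (internal⇐ B low′ f₁∈b)
        ... | inj₂ refl | _        = top

    low-walk⇒adjInf : r f < r e → Endpoint f x → Walk ends w x es vs → All (λ g → r g < r e) es →
                      f ∉ es → AdjInf e w f
    low-walk⇒adjInf rf fx W lows f∉es with walk⇒path W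
    ... | es′ , P , es′⊆es =
      rf , _ , fx , es′ , P , (λ e∈ → <-irrefl refl (All.lookup lows′ e∈)) , f∉es ∘ es′⊆es , lows′
      where lows′ = All-resp-⊇ es′⊆es lows

    cluster-internal⇔adjInf : Cluster (r e) c → LeafIn w c → InternalNode f c ⇔ AdjInf e w f
    cluster-internal⇔adjInf {e} {c} {w} {f} C w∈ = mk⇔ to from
      where
        to : InternalNode f c → AdjInf e w f
        to f∈ with internal⇒ C f∈
        ... | rf , f₁∈ with linked⇒walk (linked C w∈ f₁∈)
        ...   | _ , _ , W , lows with walk-prefix-avoiding W (inj₁ refl)
        ...     | _ , fx , _ , _ , W′ , f∉ , ⊆es = low-walk⇒adjInf rf fx W′ (All-resp-⊇ ⊆es lows) f∉

        endpoint∈⇒end₁∈ : r f < r e → Endpoint f x → LeafIn x c → LeafIn (end₁ f) c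
        endpoint∈⇒end₁∈ _  (inj₁ refl) x∈ = x∈
        endpoint∈⇒end₁∈ rf (inj₂ refl) x∈ = closed₁ C x∈ (f , rf , joins-sym (joins-ends f))

        from : AdjInf e w f → InternalNode f c
        from (rf , _ , fx , _ , (_ , W , _) , _ , _ , lows) =
          internal⇐ C rf (endpoint∈⇒end₁∈ rf fx (closed C w∈ (walk⇒linked W lows)))

    leafIn⇔hasLeaf : LeafIn x t ⇔ T (hasLeaf x t)
    leafIn⇔hasLeaf {x} {leaf y}     = mk⇔ (λ { lf → fromWitness refl })
                                          (λ x≡y → subst (λ z → LeafIn x (leaf z)) (toWitness x≡y) lf)
    leafIn⇔hasLeaf {x} {node g a b} = mk⇔ to from
      where
        to : LeafIn x (node g a b) → T (hasLeaf x a ∨ hasLeaf x b)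
        to (inl x∈) = Equivalence.from T-∨ (inj₁ (Equivalence.to leafIn⇔hasLeaf x∈))
        to (inr x∈) = Equivalence.from T-∨ (inj₂ (Equivalence.to leafIn⇔hasLeaf x∈))

        from : T (hasLeaf x a ∨ hasLeaf x b) → LeafIn x (node g a b)
        from x∈ with Equivalence.to T-∨ x∈
        ... | inj₁ x∈a = inl (Equivalence.from leafIn⇔hasLeaf x∈a)
        ... | inj₂ x∈b = inr (Equivalence.from leafIn⇔hasLeaf x∈b)

    extract-nothing : ∀ F → extract x F ≡ nothing → ¬ Any (LeafIn x) F
    extract-nothing {x} (t ∷ F) eq x∈ with hasLeaf x t in h
    extract-nothing (t ∷ F) () _ | true
    ... | false with extract x F in eq′ | x∈
    ...   | nothing | here x∈t  = subst T h (Equivalence.to leafIn⇔hasLeaf x∈t)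
    ...   | nothing | there x∈F = extract-nothing F eq′ x∈F
    extract-nothing (t ∷ F) () _ | false | just _ | _

    extract-just : ∀ F → extract x F ≡ just (t , F′) → LeafIn x t × F ↭ t ∷ F′
    extract-just {x} (s ∷ F) eq with hasLeaf x s in h
    extract-just (s ∷ F) refl | true = Equivalence.from leafIn⇔hasLeaf (Equivalence.from T-≡ h) , ↭-refl
    ... | false with extract x F in eq′
    extract-just (s ∷ F) ()   | false | nothing
    extract-just (s ∷ F) refl | false | just (t , F′) =
      map₂ (λ σ → ↭-trans (↭-prep s σ) (↭-swap s t ↭-refl)) (extract-just F eq′)

    Disjoint : BT → BT → Set
    Disjoint s t = ∀ {x} → LeafIn x s → LeafIn x t → ⊥

    disjoint-sym : Disjoint s t → Disjoint t s
    disjoint-sym s#t x∈t x∈s = s#t x∈s x∈t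

    disjoint-node : Disjoint a t → Disjoint b t → Disjoint (node e a b) t
    disjoint-node a#t _   (inl x∈a) = a#t x∈a
    disjoint-node _   b#t (inr x∈b) = b#t x∈b

    ChildrenAreClusters : BT → Set
    ChildrenAreClusters t = ∀ {g a b} → node g a b ⊑ t → Cluster (r g) a × Cluster (r g) b

    record Forest (k : ℕ) (F : List BT) : Set where
      constructor forest
      field
        covers   : ∀ x → Any (LeafIn x) F
        clusters : All (Cluster k) F
        children : All ChildrenAreClusters F
        disjoint : AllPairs Disjoint F

    open Forest

    forest-resp-↭ : F ↭ F′ → Forest k F → Forest k F′
    forest-resp-↭ σ (forest cov C N D) = forest (Any-resp-↭ σ ∘ cov) (All-resp-↭ σ C) (All-resp-↭ σ N)
      (SetoidPermutation.AllPairs-resp-↭ (setoid BT) disjoint-sym (resp₂ Disjoint) (↭⇒↭ₛ σ) D)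

    forest-leaves : Forest 0 (map leaf (allFin n))
    forest-leaves = forest
      (λ x → Anyₚ.map⁺ (Any.map (λ { refl → lf }) (∈-allFin x)))
      (Allₚ.map⁺ (All.universal (λ _ → cluster-leaf) (allFin n)))
      (Allₚ.map⁺ (All.universal (λ _ ()) (allFin n)))
      (AllPairsₚ.map⁺ (AllPairs.map (λ x≢y → λ { lf lf → x≢y refl }) (allFin⁺ n)))

    forest-join : LeafIn (end₁ e) a → LeafIn (end₂ e) b →
                  Forest (r e) (a ∷ b ∷ F) → Forest (suc (r e)) (node e a b ∷ F)
    forest-join {e} {a} {b} {F} e₁∈a e₂∈b (forest cov (A ∷ B ∷ Cs) (Na ∷ Nb ∷ Ns) ((_ ∷ a#F) ∷ b#F ∷ D)) =
      forest cov′ (cluster-node A B e₁∈a e₂∈b ∷ All.zipWith untouched (Cs , ab#F)) (children-ab ∷ Ns) (ab#F ∷ D)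
      where
        ab#F : All (Disjoint (node e a b)) F
        ab#F = All.zipWith (Product.uncurry disjoint-node) (a#F , b#F)

        untouched : Cluster (r e) t × Disjoint (node e a b) t → Cluster (suc (r e)) t
        untouched (C , ab#t) = cluster-untouched C (ab#t (inl e₁∈a)) (ab#t (inr e₂∈b))

        children-ab : ChildrenAreClusters (node e a b)
        children-ab ⊑-refl      = A , B
        children-ab (⊑-left p)  = Na p
        children-ab (⊑-right p) = Nb p

        cov′ : ∀ x → Any (LeafIn x) (node e a b ∷ F)
        cov′ x with cov x
        ... | here x∈a          = here (inl x∈a)
        ... | there (here x∈b)  = here (inr x∈b)
        ... | there (there x∈F) = there x∈F

    forest-merge : IsTree ends → r e ≡ k → Forest k F → Forest (suc k) (merge F e)
    forest-merge {e} {F = F} tree refl Φ with extract (end₁ e) F in eq₁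
    ... | nothing = ⊥-elim (extract-nothing F eq₁ (covers Φ (end₁ e)))
    ... | just (a , F′) with extract-just F eq₁ | extract (end₂ e) F′ in eq₂
    ...   | e₁∈a , σ | nothing = ⊥-elim (e₂-nowhere (Any-resp-↭ σ (covers Φ (end₂ e))))
      where
        e₂-nowhere : ¬ Any (LeafIn (end₂ e)) (a ∷ F′)
        e₂-nowhere (here e₂∈a)   = ends-unlinked tree e (linked (All.head (All-resp-↭ σ (clusters Φ))) e₁∈a e₂∈a)
        e₂-nowhere (there e₂∈F′) = extract-nothing F′ eq₂ e₂∈F′
    ...   | e₁∈a , σ | just (b , F″) with extract-just F′ eq₂
    ...     | e₂∈b , τ = forest-join e₁∈a e₂∈b (forest-resp-↭ (↭-trans σ (↭-prep a τ)) Φ)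

    forest-foldl : IsTree ends → ∀ {j} (g : Fin j → Fin m) → (∀ i → r (g i) ≡ k + toℕ i) →
                   Forest k F → ∃ λ k′ → Forest k′ (foldl merge F (tabulate g))
    forest-foldl tree {zero} g _ Φ = _ , Φ
    forest-foldl {k} tree {suc j} g rg Φ =
      forest-foldl tree (g ∘ Fin.suc) (λ i → trans (rg (Fin.suc i)) (+-suc k (toℕ i)))
        (forest-merge tree (trans (rg Fin.zero) (+-identityʳ k)) Φ)

    forest-SLD : IsTree ends → ∃ λ k → Forest k SLD
    forest-SLD tree =
      subst (λ es → ∃ λ k → Forest k (foldl merge (map leaf (allFin n)) es))
        (sym (map-tabulate id (Inverse.from rk)))
        (forest-foldl tree (Inverse.from rk) (cong toℕ ∘ Inverse.strictlyInverseˡ rk) forest-leaves)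

    SLD-child-cluster : IsTree ends → t ∈ SLD → node e a b ⊑ t → c ≡ a ⊎ c ≡ b → Cluster (r e) c
    SLD-child-cluster tree t∈ ab⊑t c≡ with All.lookup (children (proj₂ (forest-SLD tree))) t∈ ab⊑t | c≡
    ... | A , _ | inj₁ refl = A
    ... | _ , B | inj₂ refl = B

lemma3p2 : ∀ {n m : ℕ} (ends : Ends n m) (rk : Fin m ↔ Fin m) →
           IsTree ends →
           ∀ (e : Fin m) (t : Ranked.BT ends rk) → t ∈ Ranked.SLD ends rk →
           ∀ (l r : Ranked.BT ends rk) →
           Ranked._⊑_ ends rk (Ranked.node e l r) t →
           (∀ (c : Ranked.BT ends rk) → (c ≡ l ⊎ c ≡ r) →
              Ranked.LeafIn ends rk (proj₁ (ends e)) c →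
              ∀ (f : Fin m) → Ranked.InternalNode ends rk f c
                ⇔ Ranked.AdjInf ends rk e (proj₁ (ends e)) f)
           ×
           (∀ (c : Ranked.BT ends rk) → (c ≡ l ⊎ c ≡ r) →
              Ranked.LeafIn ends rk (proj₂ (ends e)) c →
              ∀ (f : Fin m) → Ranked.InternalNode ends rk f c
                ⇔ Ranked.AdjInf ends rk e (proj₂ (ends e)) f)
lemma3p2 {n} ends rk tree e t t∈ l r lr⊑t = characterise , characterise
  where
    characterise : ∀ {w : Fin n} c → c ≡ l ⊎ c ≡ r → Ranked.LeafIn ends rk w c →
                   ∀ f → Ranked.InternalNode ends rk f c ⇔ Ranked.AdjInf ends rk e w f
    characterise c c≡ w∈c f = cluster-internal⇔adjInf ends rk (SLD-child-cluster ends rk tree t∈ lr⊑t c≡) w∈c
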